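{- For every $\alpha\in\Omega$ and every $n\ge1$, \[2\,s_n(\alpha)\le s_{n+1}(\alpha^2)\le s_{n+1}(\alpha).\] Hence $\alpha$ is settled (resp. strongly settled) if and only if $\alpha^2$ is settled (resp. strongly settled).
   Context: $T$ is the rooted binary tree of finite words over $\{0,1\}$ (level $n$ = words of length $n$), $\Omega=\mathrm{Aut}(T)$. A vertex $v$ at level $n$ lies in a stable cycle of $\alpha$ of length $k$ if its $\alpha$-orbit has $k$ elements and for every $m>n$ the vertices at level $m$ above this orbit form a single $\alpha$-cycle of length $2^{m-n}k$. $s_n(\alpha)$ is the number of vertices at level $n$ lying in a stable cycle of $\alpha$. $\alpha$ is settled if $s_n(\alpha)/2^n\to1$, and strongly settled if for some $n$ every vertex at level $n$ lies in a stable cycle of $\alpha$. -}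

module Defs where

open import Level using (0ℓ)
open import Data.Bool using (Bool; true; false)
open import Data.Nat using (ℕ; zero; suc; _+_; _*_; _∸_; _^_; _≤_)
open import Data.Vec using (Vec; []; _∷_; _++_; head; tail)
open import Data.List using (List; []; _∷_; map; length; filter) renaming (_++_ to _++ˡ_)
open import Data.Product using (Σ; ∃; ∃-syntax; _×_; _,_)
open import Relation.Binary.PropositionalEquality using (_≡_; refl; cong; trans)
open import Axiom.ExcludedMiddle using (ExcludedMiddle)

-- Convention: a vertex of T at level n (a word x₁ x₂ … xₙ over {0,1},
-- 0 = false, 1 = true) is stored as the vector  xₙ ∷ … ∷ x₁ ∷ []
-- (last letter first).  Thus the children of w are  b ∷ w,  the parent of
-- b ∷ w is w (= tail), and the vertices at level n + d lying above w are
-- exactly  u ++ w  for u : Vec Bool d.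
Vertex : ℕ → Set
Vertex n = Vec Bool n

record Aut : Set where
  field
    act     : ∀ {n} → Vertex n → Vertex n
    inv     : ∀ {n} → Vertex n → Vertex n
    act-inv : ∀ {n} (v : Vertex n) → act (inv v) ≡ v
    inv-act : ∀ {n} (v : Vertex n) → inv (act v) ≡ v
    parent  : ∀ {n} (b : Bool) (v : Vertex n) → tail (act (b ∷ v)) ≡ act v
open Aut public

_∘ᴬ_ : Aut → Aut → Aut
act (α ∘ᴬ β) v = act α (act β v)
inv (α ∘ᴬ β) v = inv β (inv α v)
act-inv (α ∘ᴬ β) v = trans (cong (act α) (act-inv β (inv α v))) (act-inv α v)
inv-act (α ∘ᴬ β) v = trans (cong (inv β) (inv-act α (act β v))) (inv-act β v)
parent (α ∘ᴬ β) b v =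
  trans (cong (λ w → tail (act α w)) (lem (act β (b ∷ v))))
        (trans (parent α _ (tail (act β (b ∷ v)))) (cong (act α) (parent β b v)))
  where
  lem : ∀ {k} (w : Vec Bool (suc k)) → w ≡ head w ∷ tail w
  lem (x ∷ w) = refl

sq : Aut → Aut
sq α = α ∘ᴬ α

iter : Aut → ℕ → ∀ {n} → Vertex n → Vertex n
iter α zero    v = v
iter α (suc j) v = act α (iter α j v)

-- v (level n) lies in a stable cycle of α: for every d, the vertices at
-- level n + d lying above the α-orbit {α^i v} of v form a single α-cycle,
-- i.e. any one of them reaches every other one under some power of α.
-- (For d = 0 this is trivial; the cycle length 2^d·k is then automatic,
-- since there are exactly 2^d·k such vertices.)
Stable : Aut → ∀ {n} → Vertex n → Set
Stable α {n} v =
  ∀ (d : ℕ) (u u' : Vertex d) (i : ℕ) → ∃[ j ] iter α j (u ++ v) ≡ u' ++ iter α i v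

allVertices : (n : ℕ) → List (Vertex n)
allVertices zero    = [] ∷ []
allVertices (suc n) = map (true ∷_) (allVertices n) ++ˡ map (false ∷_) (allVertices n)

s : ExcludedMiddle 0ℓ → Aut → ℕ → ℕ
s em α n = length (filter (λ v → em {Stable α v}) (allVertices n))

-- settled: s_n(α)/2^n → 1, i.e. for every k there is N with
-- (2^n - s_n(α)) / 2^n ≤ 1/(k+1) for all n ≥ N   (note s_n(α) ≤ 2^n)
Settled : ExcludedMiddle 0ℓ → Aut → Set
Settled em α = ∀ (k : ℕ) → ∃[ N ] ∀ (n : ℕ) → N ≤ n →
  suc k * (2 ^ n ∸ s em α n) ≤ 2 ^ n

StronglySettled : Aut → Set
StronglySettled α = ∃[ n ] ∀ (v : Vertex n) → Stable α v

-- A vertex v lies in a stable cycle of α iff the powers of α act transitively on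
-- the vertices above v at every level.  Then α^k swaps the two children of v,
-- where k is the period of v, so a power of α fixing a child of v is an even
-- multiple of k; hence the powers of α² act transitively above each child of v.
-- Conversely, transitivity of the powers of α² gives that of the powers of α.
-- Counting the children of stable vertices gives both inequalities, and the
-- settledness statements follow from them.
module Submission where

open import Defs
open import Level using (0ℓ)
open import Axiom.ExcludedMiddle using (ExcludedMiddle)
open import Data.Bool using (Bool; true; false; not)
open import Data.Bool.Properties using (not-involutive; not-¬; ¬-not) renaming (_≟_ to _≟ᴮ_)
open import Data.Nat
open import Data.Nat.Properties
open import Algebra.Properties.CommutativeSemigroup *-commutativeSemigroup using (x∙yz≈y∙xz)
open import Data.Nat.DivMod using (_%_; _/_; m≡m%n+[m/n]*n; m%n<n)
open import Data.Nat.Divisibility using (_∣_; divides; m%n≡0⇒n∣m; n∣m*n*o)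
open import Data.Vec using (Vec; []; _∷_; _++_; head; _∷ʳ_; cast; splitAt)
open import Data.Vec.Properties using (++-injectiveʳ; ≡-dec; cast-is-id; ∷ʳ-++-eqFree)
open import Data.List using (List; []; _∷_; map; length; filter) renaming (_++_ to _++ˡ_)
open import Data.List.Properties using (filter-++; length-++; map-id)
open import Data.Product using (∃; ∃-syntax; _×_; _,_; proj₁; proj₂)
open import Data.Sum using (_⊎_; inj₁; inj₂; [_,_])
open import Function using (id; _∘_)
open import Function.Bundles using (_⇔_; mk⇔)
open import Relation.Nullary using (¬_; yes; no; contradiction)
open import Relation.Nullary.Decidable using (_×-dec_)
open import Relation.Unary using (Pred; Decidable)
open import Relation.Binary.PropositionalEquality using (_≡_; refl; sym; trans; cong; cong₂; subst; module ≡-Reasoning)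

module _ {P : Pred ℕ 0ℓ} (P? : Decidable P) where

  private
    Least : ℕ → Set
    Least k = P k × (∀ {t} → t < k → ¬ P t)

    least-or-none-below : ∀ m → ∃ Least ⊎ (∀ {t} → t < m → ¬ P t)
    least-or-none-below zero = inj₂ λ ()
    least-or-none-below (suc m) with least-or-none-below m
    ... | inj₁ least = inj₁ least
    ... | inj₂ none with P? m
    ...   | yes pm = inj₁ (m , pm , none)
    ...   | no ¬pm = inj₂ λ t<1+m → [ none , (λ { refl → ¬pm }) ] (m<1+n⇒m<n∨m≡n t<1+m)

  least-witness : ∀ {n} → P n → ∃[ k ] P k × (∀ {t} → t < k → ¬ P t)
  least-witness {n} pn with least-or-none-below (suc n)
  ... | inj₁ least = least
  ... | inj₂ none  = contradiction pn (none (n<1+n n))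

even-or-odd : ∀ m → ∃[ q ] (m ≡ q * 2 ⊎ m ≡ suc (q * 2))
even-or-odd zero = 0 , inj₁ refl
even-or-odd (suc m) with even-or-odd m
... | q , inj₁ m≡2q  = q , inj₂ (cong suc m≡2q)
... | q , inj₂ m≡2q+1 = suc q , inj₁ (cong suc m≡2q+1)

module _ {A B : Set} {P : Pred A 0ℓ} {Q : Pred B 0ℓ} (P? : Decidable P) (Q? : Decidable Q) where

  length-filter-map-mono : (f : A → B) → (∀ {x} → P x → Q (f x)) → ∀ xs →
                           length (filter P? xs) ≤ length (filter Q? (map f xs))
  length-filter-map-mono f P⇒Q [] = z≤n
  length-filter-map-mono f P⇒Q (x ∷ xs) with P? x | Q? (f x)
  ... | yes _  | yes _   = s≤s (length-filter-map-mono f P⇒Q xs)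
  ... | yes px | no ¬qfx = contradiction (P⇒Q px) ¬qfx
  ... | no _   | yes _   = m≤n⇒m≤1+n (length-filter-map-mono f P⇒Q xs)
  ... | no _   | no _    = length-filter-map-mono f P⇒Q xs

length-filter-mono : ∀ {A : Set} {P Q : Pred A 0ℓ} (P? : Decidable P) (Q? : Decidable Q) →
                     (∀ {x} → P x → Q x) → ∀ xs → length (filter P? xs) ≤ length (filter Q? xs)
length-filter-mono P? Q? P⇒Q xs =
  subst (λ ys → length (filter P? xs) ≤ length (filter Q? ys)) (map-id xs)
        (length-filter-map-mono P? Q? id P⇒Q xs)

module _ (α : Aut) where

  iter-+ : ∀ a b {n} (x : Vertex n) → iter α (a + b) x ≡ iter α a (iter α b x)
  iter-+ zero    b x = refl
  iter-+ (suc a) b x = cong (act α) (iter-+ a b x)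

  iter-*-fixed : ∀ {p n} {x : Vertex n} → iter α p x ≡ x → ∀ m → iter α (m * p) x ≡ x
  iter-*-fixed fix zero = refl
  iter-*-fixed {p} {x = x} fix (suc m) =
    trans (iter-+ p (m * p) x) (trans (cong (iter α p) (iter-*-fixed fix m)) fix)

  iter-sq : ∀ q {n} (x : Vertex n) → iter (sq α) q x ≡ iter α (q * 2) x
  iter-sq zero    x = refl
  iter-sq (suc q) x = cong (act α ∘ act α) (iter-sq q x)

  iter-cast : ∀ j {m m'} (e : m ≡ m') (x : Vertex m) → iter α j (cast e x) ≡ cast e (iter α j x)
  iter-cast j refl x = trans (cong (iter α j) (cast-is-id refl x)) (sym (cast-is-id refl (iter α j x)))

  iter-∷ʳ-++ : ∀ j {d n} (u u' : Vertex d) (b : Bool) (v : Vertex n) →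
               iter α j ((u ∷ʳ b) ++ v) ≡ (u' ∷ʳ b) ++ v → iter α j (u ++ b ∷ v) ≡ u' ++ b ∷ v
  iter-∷ʳ-++ j {d} {n} u u' b v eq = begin
    iter α j (u ++ b ∷ v)             ≡⟨ cong (iter α j) (sym (∷ʳ-++-eqFree b u)) ⟩
    iter α j (cast e ((u ∷ʳ b) ++ v)) ≡⟨ iter-cast j e ((u ∷ʳ b) ++ v) ⟩
    cast e (iter α j ((u ∷ʳ b) ++ v)) ≡⟨ cong (cast e) eq ⟩
    cast e ((u' ∷ʳ b) ++ v)           ≡⟨ ∷ʳ-++-eqFree b u' ⟩
    u' ++ b ∷ v                       ∎
    where
    open ≡-Reasoning
    e : suc d + n ≡ d + suc n
    e = sym (+-suc d n)

  act-injective : ∀ {n} {x y : Vertex n} → act α x ≡ act α y → x ≡ y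
  act-injective {x = x} {y} eq = trans (sym (inv-act α x)) (trans (cong (inv α) eq) (inv-act α y))

  act-++ : ∀ {d n} (u : Vertex d) (v : Vertex n) → ∃[ u' ] act α (u ++ v) ≡ u' ++ act α v
  act-++ []      v = [] , refl
  act-++ (b ∷ u) v with act α (b ∷ u ++ v) | parent α b (u ++ v) | act-++ u v
  ... | b' ∷ w | w≡α[u++v] | u' , eq = b' ∷ u' , cong (b' ∷_) (trans w≡α[u++v] eq)

  iter-++ : ∀ j {d n} (u : Vertex d) (v : Vertex n) → ∃[ u' ] iter α j (u ++ v) ≡ u' ++ iter α j v
  iter-++ zero    u v = u , refl
  iter-++ (suc j) u v with iter-++ j u v
  ... | u₁ , eq₁ with act-++ u₁ (iter α j v)
  ...   | u₂ , eq₂ = u₂ , trans (cong (act α) eq₁) eq₂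

  iter-fixes-suffix : ∀ j {d n} {u u' : Vertex d} {w : Vertex n} →
                      iter α j (u ++ w) ≡ u' ++ w → iter α j w ≡ w
  iter-fixes-suffix j {u = u} {u'} {w} eq with iter-++ j u w
  ... | u₁ , eq₁ = sym (++-injectiveʳ u' u₁ (trans (sym eq) eq₁))

  act-++-surjective : ∀ {d n} (u' : Vertex d) (y : Vertex n) → ∃[ u ] act α (u ++ y) ≡ u' ++ act α y
  act-++-surjective {d} u' y with splitAt d (inv α (u' ++ act α y))
  ... | u , y₁ , preimage≡u++y₁ with act-++ u y₁
  ...   | u₁ , eq₁ = u , subst (λ z → act α (u ++ z) ≡ u' ++ act α y) y₁≡y image
    where
    image : act α (u ++ y₁) ≡ u' ++ act α y
    image = trans (cong (act α) (sym preimage≡u++y₁)) (act-inv α (u' ++ act α y))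
    y₁≡y : y₁ ≡ y
    y₁≡y = act-injective (++-injectiveʳ u₁ u' (trans (sym eq₁) image))

  iter-++-surjective : ∀ i {d n} (u' : Vertex d) (v : Vertex n) → ∃[ u ] iter α i (u ++ v) ≡ u' ++ iter α i v
  iter-++-surjective zero    u' v = u' , refl
  iter-++-surjective (suc i) u' v with act-++-surjective u' (iter α i v)
  ... | u₁ , eq₁ with iter-++-surjective i u₁ v
  ...   | u , eq = u , trans (cong (act α) eq) eq₁

  child-image : ∀ t {n} {v : Vertex n} → iter α t v ≡ v → ∀ c →
                iter α t (c ∷ v) ≡ c ∷ v ⊎ iter α t (c ∷ v) ≡ not c ∷ v
  child-image t {v = v} fix c with iter-++ t (c ∷ []) v
  ... | h ∷ [] , eq with h ≟ᴮ c
  ...   | yes refl = inj₁ (trans eq (cong (h ∷_) fix))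
  ...   | no h≢c   = inj₂ (trans eq (cong₂ _∷_ (¬-not h≢c) fix))

  IsPeriod : ∀ {n} → Vertex n → ℕ → Set
  IsPeriod x t = 0 < t × iter α t x ≡ x

  minimal-period : ∀ {n} {x : Vertex n} {p} → IsPeriod x p →
                   ∃[ k ] IsPeriod x k × (∀ {t} → t < k → ¬ IsPeriod x t)
  minimal-period {x = x} = least-witness (λ t → 0 <? t ×-dec ≡-dec _≟ᴮ_ (iter α t x) x)

  minimal-period-∣ : ∀ {n} {x : Vertex n} {k t} → IsPeriod x k → (∀ {t} → t < k → ¬ IsPeriod x t) →
                     iter α t x ≡ x → k ∣ t
  minimal-period-∣ {x = x} {k} {t} (0<k , k-fix) minimal t-fix = m%n≡0⇒n∣m t k remainder≡0
    where
    instance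
      k≢0 : NonZero k
      k≢0 = >-nonZero 0<k
    remainder-fix : iter α (t % k) x ≡ x
    remainder-fix = begin
      iter α (t % k) x                       ≡⟨ cong (iter α (t % k)) (sym (iter-*-fixed k-fix (t / k))) ⟩
      iter α (t % k) (iter α (t / k * k) x)  ≡⟨ sym (iter-+ (t % k) (t / k * k) x) ⟩
      iter α (t % k + t / k * k) x           ≡⟨ cong (λ i → iter α i x) (sym (m≡m%n+[m/n]*n t k)) ⟩
      iter α t x                             ≡⟨ t-fix ⟩
      x                                      ∎
      where open ≡-Reasoning
    remainder≡0 : t % k ≡ 0
    remainder≡0 with 0 <? t % k
    ... | yes 0<r = contradiction (0<r , remainder-fix) (minimal (m%n<n t k))
    ... | no  0≮r = n≤0⇒n≡0 (≮⇒≥ 0≮r)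

module _ (α : Aut) {n} {v : Vertex n} (swap : ∀ c → ∃[ j ] iter α j (c ∷ v) ≡ not c ∷ v) where

  private
    swap-period : ∀ c → IsPeriod α v (proj₁ (swap c))
    swap-period c with swap c
    ... | zero  , c∷v≡¬c∷v = contradiction (cong head c∷v≡¬c∷v) (not-¬ refl)
    ... | suc j , eq        = z<s , iter-fixes-suffix α (suc j) eq

    period-of-v : ∃[ k ] IsPeriod α v k × (∀ {t} → t < k → ¬ IsPeriod α v t)
    period-of-v = minimal-period α (swap-period true)

    k : ℕ
    k = proj₁ period-of-v

    k-fix : iter α k v ≡ v
    k-fix = proj₂ (proj₁ (proj₂ period-of-v))

    fix⇒k∣ : ∀ t → iter α t v ≡ v → k ∣ t
    fix⇒k∣ t = minimal-period-∣ α (proj₁ (proj₂ period-of-v)) (proj₂ (proj₂ period-of-v))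

    -- If α^k fixed c ∷ v, so would every power of α fixing v, including the one swapping it.
    k-swaps : ∀ c → iter α k (c ∷ v) ≡ not c ∷ v
    k-swaps c with child-image α k k-fix c
    ... | inj₂ swapped = swapped
    ... | inj₁ fixed with swap c
    ...   | j , c↦¬c with fix⇒k∣ j (iter-fixes-suffix α j c↦¬c)
    ...     | divides q refl =
      contradiction (cong head (trans (sym (iter-*-fixed α fixed q)) c↦¬c)) (not-¬ refl)

    2k-fixes : ∀ c → iter α (k + k) (c ∷ v) ≡ c ∷ v
    2k-fixes c = begin
      iter α (k + k) (c ∷ v)      ≡⟨ iter-+ α k k (c ∷ v) ⟩
      iter α k (iter α k (c ∷ v)) ≡⟨ cong (iter α k) (k-swaps c) ⟩
      iter α k (not c ∷ v)        ≡⟨ k-swaps (not c) ⟩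
      not (not c) ∷ v             ≡⟨ cong (_∷ v) (not-involutive c) ⟩
      c ∷ v                       ∎
      where open ≡-Reasoning

  fixes-child⇒even : ∀ {r c} → iter α r (c ∷ v) ≡ c ∷ v → 2 ∣ r
  fixes-child⇒even {r} {c} r-fix with fix⇒k∣ r (iter-fixes-suffix α r r-fix)
  ... | divides m refl with even-or-odd m
  ...   | q , inj₁ refl = n∣m*n*o q k
  ...   | q , inj₂ refl = contradiction (cong head c∷v≡¬c∷v) (not-¬ refl)
    where
    open ≡-Reasoning
    q*2*k≡q*[k+k] : q * 2 * k ≡ q * (k + k)
    q*2*k≡q*[k+k] = trans (*-assoc q 2 k) (cong (λ i → q * (k + i)) (+-identityʳ k))
    c∷v≡¬c∷v : c ∷ v ≡ not c ∷ v
    c∷v≡¬c∷v = begin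
      c ∷ v                                   ≡⟨ sym r-fix ⟩
      iter α (k + q * 2 * k) (c ∷ v)          ≡⟨ iter-+ α k (q * 2 * k) (c ∷ v) ⟩
      iter α k (iter α (q * 2 * k) (c ∷ v))   ≡⟨ cong (λ i → iter α k (iter α i (c ∷ v))) q*2*k≡q*[k+k] ⟩
      iter α k (iter α (q * (k + k)) (c ∷ v)) ≡⟨ cong (iter α k) (iter-*-fixed α (2k-fixes c) q) ⟩
      iter α k (c ∷ v)                        ≡⟨ k-swaps c ⟩
      not c ∷ v                               ∎

TransitiveAbove : Aut → ∀ {n} → Vertex n → Set
TransitiveAbove α v = ∀ d (u u' : Vertex d) → ∃[ j ] iter α j (u ++ v) ≡ u' ++ v

module _ (α : Aut) {n} {v : Vertex n} where

  stable⇒transitiveAbove : Stable α v → TransitiveAbove α v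
  stable⇒transitiveAbove stable d u u' = stable d u u' 0

  transitiveAbove⇒stable : TransitiveAbove α v → Stable α v
  transitiveAbove⇒stable transitive d u u' i with iter-++-surjective α i u' v
  ... | w , eq with transitive d u w
  ...   | j , u↦w = i + j , (begin
    iter α (i + j) (u ++ v)      ≡⟨ iter-+ α i j (u ++ v) ⟩
    iter α i (iter α j (u ++ v)) ≡⟨ cong (iter α i) u↦w ⟩
    iter α i (w ++ v)            ≡⟨ eq ⟩
    u' ++ iter α i v             ∎)
    where open ≡-Reasoning

  transitiveAbove-of-sq : TransitiveAbove (sq α) v → TransitiveAbove α v
  transitiveAbove-of-sq transitive d u u' with transitive d u u'
  ... | q , eq = q * 2 , trans (sym (iter-sq α q (u ++ v))) eq

  transitiveAbove-sq-child : TransitiveAbove α v → ∀ b → TransitiveAbove (sq α) (b ∷ v)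
  transitiveAbove-sq-child transitive b d u u' with transitive (suc d) (u ∷ʳ b) (u' ∷ʳ b)
  ... | j , eq with fixes-child⇒even α (λ c → transitive 1 (c ∷ []) (not c ∷ [])) {j} {b}
                      (iter-fixes-suffix α j (iter-∷ʳ-++ α j u u' b v eq))
  ...   | divides q refl = q , trans (iter-sq α q (u ++ b ∷ v)) (iter-∷ʳ-++ α j u u' b v eq)

stable-of-sq : ∀ α {n} {v : Vertex n} → Stable (sq α) v → Stable α v
stable-of-sq α =
  transitiveAbove⇒stable α ∘ transitiveAbove-of-sq α ∘ stable⇒transitiveAbove (sq α)

stable-sq-child : ∀ α {n} {v : Vertex n} → Stable α v → ∀ b → Stable (sq α) (b ∷ v)
stable-sq-child α stable b =
  transitiveAbove⇒stable (sq α) (transitiveAbove-sq-child α (stable⇒transitiveAbove α stable) b)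

module _ (em : ExcludedMiddle 0ℓ) (α : Aut) where

  s[α²]≤s[α] : ∀ n → s em (sq α) n ≤ s em α n
  s[α²]≤s[α] n = length-filter-mono (λ v → em) (λ v → em) (stable-of-sq α) (allVertices n)

  2*s[α]≤s[α²] : ∀ n → 2 * s em α n ≤ s em (sq α) (suc n)
  2*s[α]≤s[α²] n = begin
    s em α n + (s em α n + 0)      ≡⟨ cong (s em α n +_) (+-identityʳ (s em α n)) ⟩
    s em α n + s em α n            ≤⟨ +-mono-≤ (children true) (children false) ⟩
    count (map (true ∷_) L) + count (map (false ∷_) L)
      ≡⟨ length-++ (filter Stable? (map (true ∷_) L)) ⟨
    length (filter Stable? (map (true ∷_) L) ++ˡ filter Stable? (map (false ∷_) L))
      ≡⟨ cong length (filter-++ Stable? (map (true ∷_) L) (map (false ∷_) L)) ⟨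
    s em (sq α) (suc n)            ∎
    where
    open ≤-Reasoning
    L = allVertices n
    Stable? : Decidable (Stable (sq α) {suc n})
    Stable? v = em
    count : List (Vertex (suc n)) → ℕ
    count = length ∘ filter Stable?
    children : ∀ b → s em α n ≤ count (map (b ∷_) L)
    children b =
      length-filter-map-mono (λ v → em) Stable? (b ∷_) (λ stable → stable-sq-child α stable b) L

HasDensityOne : (ℕ → ℕ) → Set
HasDensityOne f = ∀ (k : ℕ) → ∃[ N ] ∀ (n : ℕ) → N ≤ n → suc k * (2 ^ n ∸ f n) ≤ 2 ^ n

module _ {f g : ℕ → ℕ} where

  hasDensityOne-mono : (∀ n → f n ≤ g n) → HasDensityOne f → HasDensityOne g
  hasDensityOne-mono f≤g dense k with dense k
  ... | N , bound = N , λ n N≤n →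
    ≤-trans (*-monoʳ-≤ (suc k) (∸-monoʳ-≤ (2 ^ n) (f≤g n))) (bound n N≤n)

  hasDensityOne-double : (∀ n → 2 * f n ≤ g (suc n)) → HasDensityOne f → HasDensityOne g
  hasDensityOne-double 2f≤g dense k with dense k
  ... | N , bound = suc N , λ { (suc n) (s≤s N≤n) → begin
      suc k * (2 ^ suc n ∸ g (suc n))  ≤⟨ *-monoʳ-≤ (suc k) (∸-monoʳ-≤ (2 ^ suc n) (2f≤g n)) ⟩
      suc k * (2 * 2 ^ n ∸ 2 * f n)    ≡⟨ cong (suc k *_) (*-distribˡ-∸ 2 (2 ^ n) (f n)) ⟨
      suc k * (2 * (2 ^ n ∸ f n))      ≡⟨ x∙yz≈y∙xz (suc k) 2 (2 ^ n ∸ f n) ⟩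
      2 * (suc k * (2 ^ n ∸ f n))      ≤⟨ *-monoʳ-≤ 2 (bound n N≤n) ⟩
      2 ^ suc n                        ∎ }
    where open ≤-Reasoning

stronglySettled-sq : ∀ α → StronglySettled α → StronglySettled (sq α)
stronglySettled-sq α (n , stable) = suc n , λ { (b ∷ v) → stable-sq-child α (stable v) b }

stronglySettled-of-sq : ∀ α → StronglySettled (sq α) → StronglySettled α
stronglySettled-of-sq α (n , stable) = n , stable-of-sq α ∘ stable

proposition3p6 : (em : ExcludedMiddle 0ℓ) →
    ((α : Aut) (n : ℕ) → 1 ≤ n →
      (2 * s em α n ≤ s em (sq α) (suc n)) × (s em (sq α) (suc n) ≤ s em α (suc n)))
    × ((α : Aut) → Settled em α ⇔ Settled em (sq α))
    × ((α : Aut) → StronglySettled α ⇔ StronglySettled (sq α))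
proposition3p6 em =
  (λ α n _ → 2*s[α]≤s[α²] em α n , s[α²]≤s[α] em α (suc n)) ,
  (λ α → mk⇔ (hasDensityOne-double {s em α} {s em (sq α)} (2*s[α]≤s[α²] em α))
             (hasDensityOne-mono {s em (sq α)} {s em α} (s[α²]≤s[α] em α))) ,
  (λ α → mk⇔ (stronglySettled-sq α) (stronglySettled-of-sq α))
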